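{- Let $\mathbf a=(a_1,\dots,a_k)$ be a vector of positive integers and let $1\le i<k$ with $a_i>a_{i+1}$. Let $\mathbf b=(a_1,\dots,a_{i-1},a_{i+1},a_i,a_{i+2},\dots,a_k)$. Define $\Theta$ on permutations $x$ of the multiset $M(\mathbf a)$ as follows: regard each letter $i$ in $x$ as a left parenthesis and each letter $i+1$ as a right parenthesis, and match parentheses in the usual way (each right parenthesis is matched to the nearest still-unmatched left parenthesis to its left, if any); then change the leftmost $a_i-a_{i+1}$ unmatched occurrences of the letter $i$ into $i+1$, leaving all other letters unchanged. Then $x$ has at least $a_i-a_{i+1}$ unmatched occurrences of $i$, $\Theta$ is a bijection from the set of permutations of $M(\mathbf a)$ onto the set of permutations of $M(\mathbf b)$, and for every permutation $x$ of $M(\mathbf a)$, $x$ avoids the pattern $(123)$ if and only if $\Theta(x)$ avoids $(123)$.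
   Context: $M(\mathbf a)$ denotes the multiset containing exactly $a_j$ copies of the letter $j$ for each $j=1,\dots,k$; a permutation of it is a word using each letter $j$ exactly $a_j$ times. A word $w_1\cdots w_m$ contains $(123)$ if there are indices $t_1<t_2<t_3$ with $w_{t_1}<w_{t_2}<w_{t_3}$, and avoids $(123)$ otherwise. -}

module Defs where

open import Data.Nat using (ℕ; zero; suc; _≤_; _<_; _∸_; _≟_)
open import Data.Bool using (Bool; true; false; if_then_else_)
open import Data.List using (List; []; _∷_; reverse; take; length; lookup)
open import Data.Bool.ListAction using (any)
open import Data.List.Membership.Propositional using (_∈_)
open import Data.Fin using (Fin; toℕ) renaming (_<_ to _<ᶠ_)
open import Data.Product using (_×_; ∃; Σ)
open import Relation.Nullary using (¬_; does)
open import Relation.Binary.PropositionalEquality using (_≡_)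

count : ℕ → List ℕ → ℕ
count j [] = 0
count j (y ∷ x) = if does (y ≟ j) then suc (count j x) else count j x

-- Letters are natural numbers; the alphabet is {1,…,k}.
-- A vector a = (a₁,…,a_k) is represented as a function a : ℕ → ℕ, of which
-- only the values a 1, …, a k are ever used.

IsPermOf : (k : ℕ) → (ℕ → ℕ) → List ℕ → Set
IsPermOf k a x =
  (∀ {y} → y ∈ x → 1 ≤ y × y ≤ k) ×
  (∀ j → 1 ≤ j → j ≤ k → count j x ≡ a j)

swapAt : ℕ → (ℕ → ℕ) → (ℕ → ℕ)
swapAt i a j = if does (j ≟ i) then a (suc i)
               else if does (j ≟ suc i) then a i else a j

-- Parenthesis matching, scanning left to right: letter i is a left
-- parenthesis, letter i+1 a right parenthesis; each right parenthesis is
-- matched with the nearest still-unmatched left parenthesis to its left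
-- (the top of the stack), if any.  `scan i n st w` processes w whose first
-- letter has position n, with st the stack of positions of currently
-- unmatched left parentheses (top first); it returns the positions of the
-- unmatched occurrences of i at the end, in increasing order.
scan : (i : ℕ) → ℕ → List ℕ → List ℕ → List ℕ
scan i n st [] = reverse st
scan i n st (y ∷ w) with does (y ≟ i) | does (y ≟ suc i) | st
... | true  | _     | _        = scan i (suc n) (n ∷ st) w
... | false | true  | []       = scan i (suc n) [] w
... | false | true  | _ ∷ st'  = scan i (suc n) st' w
... | false | false | _        = scan i (suc n) st w

-- positions (0-based, increasing) of the unmatched occurrences of i in x
unmatched : (i : ℕ) → List ℕ → List ℕ
unmatched i x = scan i 0 [] x

replaceAt : List ℕ → ℕ → ℕ → List ℕ → List ℕ
replaceAt ps c n [] = []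
replaceAt ps c n (y ∷ w) =
  (if any (λ p → does (p ≟ n)) ps then c else y) ∷ replaceAt ps c (suc n) w

Θ : (i d : ℕ) → List ℕ → List ℕ
Θ i d x = replaceAt (take d (unmatched i x)) (suc i) 0 x

Contains123 : List ℕ → Set
Contains123 x = ∃ λ (t₁ : Fin (length x)) → ∃ λ (t₂ : Fin (length x)) → ∃ λ (t₃ : Fin (length x)) →
  t₁ <ᶠ t₂ × t₂ <ᶠ t₃ × lookup x t₁ < lookup x t₂ × lookup x t₂ < lookup x t₃

Avoids123 : List ℕ → Set
Avoids123 x = ¬ Contains123 x

module Submission where

-- Scan the word with a stack of the positions of the still unmatched openers i.  The
-- raised letters are the bottom d entries of the final stack, so each arrives when every
-- earlier opener is matched or raised itself; in Θ(x) it is therefore an unmatched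
-- closer, and the stack of x is that of Θ(x) with the raised positions underneath.  Since
-- (#unmatched closers) + #i = #(i+1) + (#unmatched openers), x has at least a_i − a_{i+1}
-- unmatched openers, and lowering the last d unmatched closers of a word inverts Θ.  If x
-- has a raised position that y lacks while Θ(x) = Θ(y), the stacks force every raised
-- position of y to be raised in x as well, contradicting that both have d of them.
-- For 123 the key facts are that between a raised position and a later i+1 there is an
-- unraised i, and between an unraised i and a later raised position there is an i+1.

open import Defs
open import Data.Bool using (Bool; true; false; if_then_else_; _∧_; _∨_)
open import Data.Bool.ListAction using (any)
open import Data.Bool.Properties using (∨-zeroʳ; ∧-conicalˡ; ∧-conicalʳ)
open import Data.Empty using (⊥; ⊥-elim)
open import Data.Fin using (Fin; toℕ; fromℕ<)
import Data.Fin as Fin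
open import Data.Fin.Properties using (toℕ<n; toℕ-fromℕ<)
open import Data.List using (List; []; _∷_; _++_; reverse; take; drop; length; lookup; null)
open import Data.List.Properties using (unfold-reverse; ++-identityʳ; reverse-++; length-reverse)
open import Data.List.Membership.Propositional using (_∈_)
open import Data.List.Membership.Propositional.Properties using (∈-++⁺ˡ; ∈-++⁺ʳ)
open import Data.List.Relation.Unary.All as All using ([]; _∷_)
open import Data.List.Relation.Unary.AllPairs using (AllPairs; []; _∷_)
import Data.List.Relation.Unary.AllPairs.Properties as AllPairs
open import Data.List.Relation.Unary.Any using (here; there)
import Data.List.Relation.Unary.Any.Properties as Any
open import Data.Nat using (ℕ; zero; suc; _+_; _∸_; _≤_; _<_; _>_; _≟_; _<?_; _≤?_; z≤n; s≤s; s≤s⁻¹)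
open import Data.List.Membership.DecPropositional _≟_ using (_∈?_)
open import Data.Nat.Properties
open import Algebra.Properties.CommutativeSemigroup +-commutativeSemigroup using (x∙yz≈y∙xz)
open import Data.Product using (_×_; ∃; _,_; proj₁; proj₂)
open import Function.Bundles using (_⇔_; mk⇔)
open import Data.Sum using (_⊎_; inj₁; inj₂)
open import Relation.Nullary using (¬_; Dec; does; yes; no)
open import Relation.Nullary.Decidable using (dec-true; dec-false)
open import Relation.Binary.PropositionalEquality

false≢true : false ≢ true
false≢true ()

does≡true⇒ : ∀ {A : Set} (a? : Dec A) → does a? ≡ true → A
does≡true⇒ (yes a) _ = a

does≡false⇒ : ∀ {A : Set} (a? : Dec A) → does a? ≡ false → ¬ A
does≡false⇒ (no ¬a) _ = ¬a

null≡true⇒≡[] : ∀ (l : List ℕ) → null l ≡ true → l ≡ []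
null≡true⇒≡[] [] _ = refl

-- The letter at position t, with the junk value 0 past the end of the word.
at : List ℕ → ℕ → ℕ
at []      _       = 0
at (y ∷ w) zero    = y
at (y ∷ w) (suc t) = at w t

at-beyond : ∀ w {t} → length w ≤ t → at w t ≡ 0
at-beyond []      _         = refl
at-beyond (y ∷ w) (s≤s len≤t) = at-beyond w len≤t

at≡suc⇒< : ∀ w t {c} → at w t ≡ suc c → t < length w
at≡suc⇒< w t eq with t <? length w
... | yes t<len = t<len
... | no  t≮len = ⊥-elim (0≢1+n (trans (sym (at-beyond w (≮⇒≥ t≮len))) eq))

at-ext : ∀ w w' → length w ≡ length w' →
               (∀ t → t < length w → at w t ≡ at w' t) → w ≡ w'
at-ext []      []       _  _  = refl
at-ext (y ∷ w) (y' ∷ w') eq at≡ =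
  cong₂ _∷_ (at≡ zero (s≤s z≤n))
            (at-ext w w' (suc-injective eq) (λ t t<len → at≡ (suc t) (s≤s t<len)))

lookup≡at : ∀ w (t : Fin (length w)) → lookup w t ≡ at w (toℕ t)
lookup≡at (y ∷ w) Fin.zero    = refl
lookup≡at (y ∷ w) (Fin.suc t) = lookup≡at w t

_∈ᵇ_ : ℕ → List ℕ → Bool
n ∈ᵇ ps = any (λ p → does (p ≟ n)) ps

∈ᵇ⇒∈ : ∀ n ps → n ∈ᵇ ps ≡ true → n ∈ ps
∈ᵇ⇒∈ n (p ∷ ps) eq with p ≟ n
... | yes refl = here refl
... | no  p≢n  = there (∈ᵇ⇒∈ n ps (subst (λ b → b ∨ n ∈ᵇ ps ≡ true) (dec-false (p ≟ n) p≢n) eq))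

∈⇒∈ᵇ : ∀ n ps → n ∈ ps → n ∈ᵇ ps ≡ true
∈⇒∈ᵇ n (p ∷ ps) (here refl) rewrite dec-true (n ≟ n) refl = refl
∈⇒∈ᵇ n (p ∷ ps) (there n∈ps) = trans (cong (does (p ≟ n) ∨_) (∈⇒∈ᵇ n ps n∈ps)) (∨-zeroʳ _)

relabel : (ℕ → Bool) → ℕ → ℕ → List ℕ → List ℕ
relabel Q c n []      = []
relabel Q c n (y ∷ w) = (if Q n then c else y) ∷ relabel Q c (suc n) w

replaceAt≡relabel : ∀ ps c n w → replaceAt ps c n w ≡ relabel (_∈ᵇ ps) c n w
replaceAt≡relabel ps c n []      = refl
replaceAt≡relabel ps c n (y ∷ w) = cong (_ ∷_) (replaceAt≡relabel ps c (suc n) w)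

length-relabel : ∀ Q c n w → length (relabel Q c n w) ≡ length w
length-relabel Q c n []      = refl
length-relabel Q c n (y ∷ w) = cong suc (length-relabel Q c (suc n) w)

∈-relabel⁻ : ∀ Q c n w {y} → y ∈ relabel Q c n w → y ≡ c ⊎ y ∈ w
∈-relabel⁻ Q c n (y ∷ w) (here refl) with Q n
... | true  = inj₁ refl
... | false = inj₂ (here refl)
∈-relabel⁻ Q c n (y ∷ w) (there y∈) with ∈-relabel⁻ Q c (suc n) w y∈
... | inj₁ y≡c = inj₁ y≡c
... | inj₂ y∈w = inj₂ (there y∈w)

at-relabel-< : ∀ Q c n w t → t < length w →
               at (relabel Q c n w) t ≡ (if Q (n + t) then c else at w t)
at-relabel-< Q c n (y ∷ w) zero    _ rewrite +-identityʳ n = refl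
at-relabel-< Q c n (y ∷ w) (suc t) (s≤s t<len) rewrite +-suc n t = at-relabel-< Q c (suc n) w t t<len

at-relabel : ∀ Q c w → (∀ {t} → Q t ≡ true → t < length w) →
             ∀ t → at (relabel Q c 0 w) t ≡ (if Q t then c else at w t)
at-relabel Q c w Q⇒< t with t <? length w
... | yes t<len = at-relabel-< Q c 0 w t t<len
... | no  t≮len with Q t in Qt
...   | true  = ⊥-elim (t≮len (Q⇒< Qt))
...   | false = trans (at-beyond (relabel Q c 0 w) (subst (_≤ t) (sym (length-relabel Q c 0 w)) (≮⇒≥ t≮len)))
                      (sym (at-beyond w (≮⇒≥ t≮len)))

𝟙 : Bool → ℕ
𝟙 true  = 1
𝟙 false = 0

countBelow : (ℕ → Bool) → ℕ → ℕ
countBelow Q zero    = 0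
countBelow Q (suc t) = 𝟙 (Q t) + countBelow Q t

countBelow-mono : ∀ Q {m n} → m ≤ n → countBelow Q m ≤ countBelow Q n
countBelow-mono Q {n = zero} z≤n = z≤n
countBelow-mono Q {m} {suc n} m≤1+n with m ≟ suc n
... | yes refl = ≤-refl
... | no  m≢   = m≤n⇒m≤o+n (𝟙 (Q n)) (countBelow-mono Q (s≤s⁻¹ (≤∧≢⇒< m≤1+n m≢)))

countBelow-⊆ : ∀ Q Q' → (∀ {q} → Q q ≡ true → Q' q ≡ true) → ∀ n → countBelow Q n ≤ countBelow Q' n
countBelow-⊆ Q Q' Q⊆Q' zero = z≤n
countBelow-⊆ Q Q' Q⊆Q' (suc n) with Q n in Qn
... | true rewrite Q⊆Q' Qn = s≤s (countBelow-⊆ Q Q' Q⊆Q' n)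
... | false = ≤-trans (countBelow-⊆ Q Q' Q⊆Q' n) (m≤n+m _ (𝟙 (Q' n)))

countBelow-⊂ : ∀ Q Q' → (∀ {q} → Q q ≡ true → Q' q ≡ true) →
               ∀ {t n} → t < n → Q' t ≡ true → Q t ≡ false → countBelow Q n < countBelow Q' n
countBelow-⊂ Q Q' Q⊆Q' {t} {suc n} (s≤s t≤n) Q't Qt with t ≟ n
... | yes refl rewrite Q't | Qt = s≤s (countBelow-⊆ Q Q' Q⊆Q' t)
... | no  t≢n with Q n in Qn
...   | true rewrite Q⊆Q' Qn = s≤s (countBelow-⊂ Q Q' Q⊆Q' (≤∧≢⇒< t≤n t≢n) Q't Qt)
...   | false = <-≤-trans (countBelow-⊂ Q Q' Q⊆Q' (≤∧≢⇒< t≤n t≢n) Q't Qt) (m≤n+m _ (𝟙 (Q' n)))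

countBelow-strict : ∀ Q {e t} → Q e ≡ true → e < t → countBelow Q e < countBelow Q t
countBelow-strict Q {e} {t} Qe e<t = subst (_≤ countBelow Q t) (cong (λ b → 𝟙 b + countBelow Q e) Qe) (countBelow-mono Q e<t)

positions : (ℕ → Bool) → ℕ → List ℕ
positions Q zero    = []
positions Q (suc t) = if Q t then t ∷ positions Q t else positions Q t

∈-positions⁻ : ∀ Q t {q} → q ∈ positions Q t → q < t × Q q ≡ true
∈-positions⁻ Q (suc t) q∈ with Q t in Qt
... | false = let q<t , Qq = ∈-positions⁻ Q t q∈ in m<n⇒m<1+n q<t , Qq
∈-positions⁻ Q (suc t) (here refl)  | true = n<1+n t , Qt
∈-positions⁻ Q (suc t) (there q∈)   | true = let q<t , Qq = ∈-positions⁻ Q t q∈ in m<n⇒m<1+n q<t , Qq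

∈-positions⁺ : ∀ Q t {q} → q < t → Q q ≡ true → q ∈ positions Q t
∈-positions⁺ Q (suc t) {q} q<1+t Qq with q ≟ t
... | yes refl rewrite Qq = here refl
... | no  q≢t with Q t
...   | true  = there (∈-positions⁺ Q t (≤∧≢⇒< (s≤s⁻¹ q<1+t) q≢t) Qq)
...   | false = ∈-positions⁺ Q t (≤∧≢⇒< (s≤s⁻¹ q<1+t) q≢t) Qq

length-positions : ∀ Q t → length (positions Q t) ≡ countBelow Q t
length-positions Q zero = refl
length-positions Q (suc t) with Q t
... | true  = cong suc (length-positions Q t)
... | false = length-positions Q t

occurrences : ℕ → List ℕ → ℕ → ℕ
occurrences j x = countBelow (λ t → does (at x t ≟ j))

occurrences-∷ : ∀ j y x t → occurrences j (y ∷ x) (suc t) ≡ 𝟙 (does (y ≟ j)) + occurrences j x t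
occurrences-∷ j y x zero = refl
occurrences-∷ j y x (suc t) rewrite occurrences-∷ j y x t = x∙yz≈y∙xz (𝟙 (does (at x t ≟ j))) (𝟙 (does (y ≟ j))) (occurrences j x t)

if-suc≡𝟙+ : ∀ b n → (if b then suc n else n) ≡ 𝟙 b + n
if-suc≡𝟙+ true  n = refl
if-suc≡𝟙+ false n = refl

count≡occurrences : ∀ j x → count j x ≡ occurrences j x (length x)
count≡occurrences j []      = refl
count≡occurrences j (y ∷ x) = begin
  count j (y ∷ x)                                ≡⟨ if-suc≡𝟙+ (does (y ≟ j)) (count j x) ⟩
  𝟙 (does (y ≟ j)) + count j x                   ≡⟨ cong (𝟙 (does (y ≟ j)) +_) (count≡occurrences j x) ⟩
  𝟙 (does (y ≟ j)) + occurrences j x (length x)  ≡⟨ occurrences-∷ j y x (length x) ⟨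
  occurrences j (y ∷ x) (length (y ∷ x))         ∎
  where open ≡-Reasoning

Descending Ascending : List ℕ → Set
Descending = AllPairs _>_
Ascending  = AllPairs _<_

reverse-descending : ∀ {l} → Descending l → Ascending (reverse l)
reverse-descending [] = []
reverse-descending {a ∷ l} (a>l ∷ l↓) rewrite unfold-reverse a l =
  AllPairs.++⁺ (reverse-descending l↓) ([] ∷ [])
    (All.tabulate (λ y∈ → All.lookup a>l (Any.reverse⁻ y∈) ∷ []))

descending-head∉ : ∀ {e r} → Descending (e ∷ r) → ¬ e ∈ r
descending-head∉ (e>r ∷ _) e∈r = <-irrefl refl (All.lookup e>r e∈r)

descending-disjoint : ∀ A {B q} → Descending (A ++ B) → q ∈ A → q ∈ B → ⊥
descending-disjoint (a ∷ A) (a>AB ∷ _) (here refl) q∈B = <-irrefl refl (All.lookup a>AB (∈-++⁺ʳ A q∈B))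
descending-disjoint (a ∷ A) (_ ∷ AB↓)  (there q∈A) q∈B = descending-disjoint A AB↓ q∈A q∈B

∈-take⁻ : ∀ d (l : List ℕ) {y} → y ∈ take d l → y ∈ l
∈-take⁻ (suc d) (a ∷ l) (here y≡a) = here y≡a
∈-take⁻ (suc d) (a ∷ l) (there y∈) = there (∈-take⁻ d l y∈)

take-downClosed : ∀ d {l p q} → Ascending l → p ∈ take d l → q ∈ l → q < p → q ∈ take d l
take-downClosed (suc d) (a<l ∷ l↑) (here refl) (here refl)  q<p = here refl
take-downClosed (suc d) (a<l ∷ l↑) (here refl) (there q∈l) q<p = ⊥-elim (<-asym q<p (All.lookup a<l q∈l))
take-downClosed (suc d) (a<l ∷ l↑) (there p∈) (here refl)  q<p = here refl
take-downClosed (suc d) (a<l ∷ l↑) (there p∈) (there q∈l) q<p = there (take-downClosed d l↑ p∈ q∈l q<p)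

length-of-take-prefix : ∀ d A B → Ascending (A ++ B) → d ≤ length (A ++ B) →
                        (∀ {a} → a ∈ A → a ∈ take d (A ++ B)) →
                        (∀ {b} → b ∈ B → ¬ b ∈ take d (A ++ B)) → length A ≡ d
length-of-take-prefix zero    []      B       _ _ _ _ = refl
length-of-take-prefix (suc d) []      (b ∷ B) _ _ _ B∉ = ⊥-elim (B∉ (here refl) (here refl))
length-of-take-prefix zero    (a ∷ A) B       _ _ A⊆ with () ← A⊆ (here refl)
length-of-take-prefix (suc d) (a ∷ A) B (a<AB ∷ AB↑) (s≤s d≤len) A⊆ B∉ =
  cong suc (length-of-take-prefix d A B AB↑ d≤len A⊆' (λ b∈B b∈ → B∉ b∈B (there b∈)))
  where
  A⊆' : ∀ {a'} → a' ∈ A → a' ∈ take d (A ++ B)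
  A⊆' a'∈A with A⊆ (there a'∈A)
  ... | here refl = ⊥-elim (<-irrefl refl (All.lookup a<AB (∈-++⁺ˡ a'∈A)))
  ... | there a'∈ = a'∈

take-length-++ : ∀ (A B : List ℕ) → take (length A) (A ++ B) ≡ A
take-length-++ []      B = refl
take-length-++ (a ∷ A) B = cong (a ∷_) (take-length-++ A B)

Contains123ᵢ : List ℕ → Set
Contains123ᵢ w = ∃ λ t₁ → ∃ λ t₂ → ∃ λ t₃ →
  t₁ < t₂ × t₂ < t₃ × t₃ < length w × at w t₁ < at w t₂ × at w t₂ < at w t₃

Contains123⇒Contains123ᵢ : ∀ w → Contains123 w → Contains123ᵢ w
Contains123⇒Contains123ᵢ w (t₁ , t₂ , t₃ , t₁<t₂ , t₂<t₃ , w₁<w₂ , w₂<w₃) =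
  toℕ t₁ , toℕ t₂ , toℕ t₃ , t₁<t₂ , t₂<t₃ , toℕ<n t₃ ,
  subst₂ _<_ (lookup≡at w t₁) (lookup≡at w t₂) w₁<w₂ ,
  subst₂ _<_ (lookup≡at w t₂) (lookup≡at w t₃) w₂<w₃

Contains123ᵢ⇒Contains123 : ∀ w → Contains123ᵢ w → Contains123 w
Contains123ᵢ⇒Contains123 w (t₁ , t₂ , t₃ , t₁<t₂ , t₂<t₃ , t₃<len , w₁<w₂ , w₂<w₃) =
  fromℕ< t₁<len , fromℕ< t₂<len , fromℕ< t₃<len ,
  subst₂ _<_ (sym (toℕ-fromℕ< t₁<len)) (sym (toℕ-fromℕ< t₂<len)) t₁<t₂ ,
  subst₂ _<_ (sym (toℕ-fromℕ< t₂<len)) (sym (toℕ-fromℕ< t₃<len)) t₂<t₃ ,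
  subst₂ _<_ (sym (lookupFin t₁ t₁<len)) (sym (lookupFin t₂ t₂<len)) w₁<w₂ ,
  subst₂ _<_ (sym (lookupFin t₂ t₂<len)) (sym (lookupFin t₃ t₃<len)) w₂<w₃
  where
  t₂<len = <-trans t₂<t₃ t₃<len
  t₁<len = <-trans t₁<t₂ t₂<len
  lookupFin : ∀ t (t<len : t < length w) → lookup w (fromℕ< t<len) ≡ at w t
  lookupFin t t<len = trans (lookup≡at w (fromℕ< t<len)) (cong (at w) (toℕ-fromℕ< t<len))

-- Parenthesis matching

pop : List ℕ → List ℕ
pop []      = []
pop (_ ∷ s) = s

∈-pop⁻ : ∀ {q} st → q ∈ pop st → q ∈ st
∈-pop⁻ (_ ∷ _) q∈ = there q∈

pop-descending : ∀ {l} → Descending l → Descending (pop l)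
pop-descending []      = []
pop-descending (_ ∷ l↓) = l↓

module Matching (i : ℕ) where

  -- One step of scan; its clauses mirror those of scan so that scan-∷ holds by refl.
  step : ℕ → List ℕ → ℕ → List ℕ
  step n st y with does (y ≟ i) | does (y ≟ suc i) | st
  ... | true  | _     | _        = n ∷ st
  ... | false | true  | []       = []
  ... | false | true  | _ ∷ st'  = st'
  ... | false | false | _        = st

  scan-∷ : ∀ n st y w → scan i n st (y ∷ w) ≡ scan i (suc n) (step n st y) w
  scan-∷ n st y w with does (y ≟ i) | does (y ≟ suc i) | st
  ... | true  | _     | _        = refl
  ... | false | true  | []       = refl
  ... | false | true  | _ ∷ st'  = refl
  ... | false | false | _        = refl

  step-opener : ∀ n st → step n st i ≡ n ∷ st
  step-opener n st rewrite dec-true (i ≟ i) refl = refl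

  step-closer : ∀ n st → step n st (suc i) ≡ pop st
  step-closer n []      rewrite dec-false (suc i ≟ i) 1+n≢n | dec-true (suc i ≟ suc i) refl = refl
  step-closer n (_ ∷ _) rewrite dec-false (suc i ≟ i) 1+n≢n | dec-true (suc i ≟ suc i) refl = refl

  step-other : ∀ n st y → y ≢ i → y ≢ suc i → step n st y ≡ st
  step-other n []      y y≢i y≢1+i rewrite dec-false (y ≟ i) y≢i | dec-false (y ≟ suc i) y≢1+i = refl
  step-other n (_ ∷ _) y y≢i y≢1+i rewrite dec-false (y ≟ i) y≢i | dec-false (y ≟ suc i) y≢1+i = refl

  data Step (n : ℕ) (st : List ℕ) (y : ℕ) : Set where
    opener : y ≡ i     → step n st y ≡ n ∷ st → Step n st y
    closer : y ≡ suc i → step n st y ≡ pop st → Step n st y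
    other  : y ≢ i → y ≢ suc i → step n st y ≡ st → Step n st y

  classify : ∀ n st y → Step n st y
  classify n st y with y ≟ i | y ≟ suc i
  ... | yes refl | _        = opener refl (step-opener n st)
  ... | no  y≢i  | yes refl = closer refl (step-closer n st)
  ... | no  y≢i  | no y≢1+i = other y≢i y≢1+i (step-other n st y y≢i y≢1+i)

  ∈-step⁻ : ∀ n st y {q} → q ∈ step n st y → q ≡ n ⊎ q ∈ st
  ∈-step⁻ n st y q∈ with classify n st y
  ... | opener _ eq rewrite eq with q∈
  ...   | here q≡n = inj₁ q≡n
  ...   | there q∈st = inj₂ q∈st
  ∈-step⁻ n st y q∈ | closer _ eq rewrite eq = inj₂ (∈-pop⁻ st q∈)
  ∈-step⁻ n st y q∈ | other _ _ eq rewrite eq = inj₂ q∈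

  stack : List ℕ → ℕ → List ℕ
  stack x zero    = []
  stack x (suc t) = step t (stack x t) (at x t)

  run : ℕ → List ℕ → List ℕ → List ℕ
  run n st []      = st
  run n st (y ∷ w) = run (suc n) (step n st y) w

  scan≡reverse-run : ∀ n st w → scan i n st w ≡ reverse (run n st w)
  scan≡reverse-run n st []      = refl
  scan≡reverse-run n st (y ∷ w) = trans (scan-∷ n st y w) (scan≡reverse-run (suc n) (step n st y) w)

  drop-∷ : ∀ (x : List ℕ) m {y w} → drop m x ≡ y ∷ w → at x m ≡ y × drop (suc m) x ≡ w
  drop-∷ (a ∷ x) zero    refl = refl , refl
  drop-∷ (a ∷ x) (suc m) eq   = drop-∷ x m eq

  run-stack : ∀ x w m → drop m x ≡ w → run m (stack x m) w ≡ stack x (m + length w)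
  run-stack x []      m _ rewrite +-identityʳ m = refl
  run-stack x (y ∷ w) m eq with drop-∷ x m eq
  ... | xₘ≡y , rest rewrite +-suc m (length w) | sym xₘ≡y = run-stack x w (suc m) rest

  unmatched≡reverse-stack : ∀ x → unmatched i x ≡ reverse (stack x (length x))
  unmatched≡reverse-stack x = trans (scan≡reverse-run 0 [] x) (cong reverse (run-stack x x 0 refl))

  ∈-stack⁻ : ∀ x t {q} → q ∈ stack x t → q < t × at x q ≡ i
  ∈-stack⁻ x (suc t) q∈ with ∈-step⁻ t (stack x t) (at x t) q∈
  ... | inj₂ q∈′ = let q<t , xq≡i = ∈-stack⁻ x t q∈′ in m<n⇒m<1+n q<t , xq≡i
  ... | inj₁ refl with classify t (stack x t) (at x t)
  ...   | opener xt≡i _ = n<1+n t , xt≡i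
  ...   | closer _ eq rewrite eq = ⊥-elim (<-irrefl refl (proj₁ (∈-stack⁻ x t (∈-pop⁻ (stack x t) q∈))))
  ...   | other _ _ eq rewrite eq = ⊥-elim (<-irrefl refl (proj₁ (∈-stack⁻ x t q∈)))

  stack-descending : ∀ x t → Descending (stack x t)
  stack-descending x zero = []
  stack-descending x (suc t) with classify t (stack x t) (at x t)
  ... | opener _ eq rewrite eq = All.tabulate (λ q∈ → proj₁ (∈-stack⁻ x t q∈)) ∷ stack-descending x t
  ... | closer _ eq rewrite eq = pop-descending (stack-descending x t)
  ... | other _ _ eq rewrite eq = stack-descending x t

  ∈-stack-suc⇒∈-stack : ∀ x t {q} → q ∈ stack x (suc t) → q < t → q ∈ stack x t
  ∈-stack-suc⇒∈-stack x t q∈ q<t with ∈-step⁻ t (stack x t) (at x t) q∈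
  ... | inj₁ refl = ⊥-elim (<-irrefl refl q<t)
  ... | inj₂ q∈′  = q∈′

  ∈-stack-later⇒∈-stack : ∀ x t k {q} → q ∈ stack x (t + k) → q < t → q ∈ stack x t
  ∈-stack-later⇒∈-stack x t zero    q∈ q<t rewrite +-identityʳ t = q∈
  ∈-stack-later⇒∈-stack x t (suc k) q∈ q<t rewrite +-suc t k =
    ∈-stack-later⇒∈-stack x t k (∈-stack-suc⇒∈-stack x (t + k) q∈ (<-≤-trans q<t (m≤m+n t k))) q<t

  stack-below-persists : ∀ x m k s e r → stack x m ≡ s ++ e ∷ r → e ∈ stack x (m + k) →
                         ∃ λ s′ → stack x (m + k) ≡ s′ ++ e ∷ r
  stack-below-persists x m zero s e r eq _ rewrite +-identityʳ m = s , eq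
  stack-below-persists x m (suc k) s e r eq e∈ rewrite +-suc m k
    with stack-below-persists x m k s e r eq (∈-stack-suc⇒∈-stack x (m + k) e∈ (<-≤-trans e<m (m≤m+n m k)))
       | classify (m + k) (stack x (m + k)) (at x (m + k))
    where e<m = proj₁ (∈-stack⁻ x m (subst (e ∈_) (sym eq) (∈-++⁺ʳ s (here refl))))
  ... | s′ , eq′ | opener _ st rewrite st | eq′ = (m + k) ∷ s′ , refl
  ... | s′ , eq′ | other _ _ st rewrite st | eq′ = s′ , refl
  ... | s″ ∷ s′ , eq′ | closer _ st rewrite st | eq′ = s′ , refl
  ... | [] , eq′ | closer _ st =
        ⊥-elim (descending-head∉ (subst Descending eq′ (stack-descending x (m + k)))
                                 (subst (e ∈_) (cong pop eq′) (subst (e ∈_) st e∈)))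

  under-opener-persists : ∀ x t k {q} → t ∈ stack x (suc t + k) → q ∈ stack x t → q ∈ stack x (suc t + k)
  under-opener-persists x t k {q} t∈ q∈ with stack-below-persists x (suc t) k [] t (stack x t) pushed t∈
    where
    pushed : stack x (suc t) ≡ t ∷ stack x t
    pushed rewrite proj₂ (∈-stack⁻ x (suc t + k) t∈) = step-opener t (stack x t)
  ... | s′ , eq = subst (q ∈_) (sym eq) (∈-++⁺ʳ s′ (there q∈))

  popped⇒closer : ∀ x q m → q ∈ stack x (suc q) → ¬ q ∈ stack x m → suc q ≤ m →
                  ∃ λ r → q < r × r < m × at x r ≡ suc i
  popped⇒closer x q (suc m) q∈ q∉ q<1+m with m ≟ q
  ... | yes refl = ⊥-elim (q∉ q∈)
  ... | no  m≢q with q ∈? stack x m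
  ...   | no q∉′ = let r , q<r , r<m , xr = popped⇒closer x q m q∈ q∉′ q<m in r , q<r , m<n⇒m<1+n r<m , xr
    where q<m = ≤∧≢⇒< (s≤s⁻¹ q<1+m) (λ q≡m → m≢q (sym q≡m))
  ...   | yes q∈′ with classify m (stack x m) (at x m)
  ...     | opener _ eq  = ⊥-elim (q∉ (subst (q ∈_) (sym eq) (there q∈′)))
  ...     | other _ _ eq = ⊥-elim (q∉ (subst (q ∈_) (sym eq) q∈′))
  ...     | closer xm _  = m , ≤∧≢⇒< (s≤s⁻¹ q<1+m) (λ q≡m → m≢q (sym q≡m)) , n<1+n m , xm

  unmatchedCloser : List ℕ → ℕ → Bool
  unmatchedCloser x t = does (at x t ≟ suc i) ∧ null (stack x t)

  balance : ∀ x t → countBelow (unmatchedCloser x) t + occurrences i x t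
                  ≡ occurrences (suc i) x t + length (stack x t)
  balance x zero = refl
  balance x (suc t) with classify t (stack x t) (at x t) | balance x t
  ... | opener xt≡i eq | ih
    rewrite eq | xt≡i | dec-true (i ≟ i) refl | dec-false (i ≟ suc i) (λ i≡1+i → 1+n≢n (sym i≡1+i)) =
      trans (+-suc _ _) (trans (cong suc ih) (sym (+-suc _ _)))
  ... | other xt≢i xt≢1+i eq | ih rewrite eq | dec-false (at x t ≟ i) xt≢i | dec-false (at x t ≟ suc i) xt≢1+i = ih
  ... | closer xt≡1+i eq | ih
    rewrite eq | xt≡1+i | dec-true (suc i ≟ suc i) refl | dec-false (suc i ≟ i) 1+n≢n with stack x t
  ...   | []    = cong suc ih
  ...   | _ ∷ _ = trans ih (+-suc _ _)

  count-∸-count≤unmatched : ∀ x → count i x ∸ count (suc i) x ≤ length (unmatched i x)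
  count-∸-count≤unmatched x = begin
    count i x ∸ count (suc i) x    ≡⟨ cong₂ _∸_ (count≡occurrences i x) (count≡occurrences (suc i) x) ⟩
    oᵢ ∸ oᵢ₊₁                      ≤⟨ m≤n+o⇒m∸n≤o oᵢ oᵢ₊₁ (subst (oᵢ ≤_) (balance x (length x)) (m≤n+m oᵢ _)) ⟩
    length (stack x (length x))    ≡⟨ length-reverse (stack x (length x)) ⟨
    length (reverse (stack x (length x))) ≡⟨ cong length (unmatched≡reverse-stack x) ⟨
    length (unmatched i x)         ∎
    where
    open ≤-Reasoning
    oᵢ   = occurrences i x (length x)
    oᵢ₊₁ = occurrences (suc i) x (length x)

  count-∸-count≤unmatchedClosers : ∀ y → count (suc i) y ∸ count i y ≤ countBelow (unmatchedCloser y) (length y)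
  count-∸-count≤unmatchedClosers y = begin
    count (suc i) y ∸ count i y    ≡⟨ cong₂ _∸_ (count≡occurrences (suc i) y) (count≡occurrences i y) ⟩
    oᵢ₊₁ ∸ oᵢ                      ≤⟨ m≤n+o⇒m∸n≤o oᵢ₊₁ oᵢ (subst (oᵢ₊₁ ≤_) balance′ (m≤m+n oᵢ₊₁ _)) ⟩
    countBelow (unmatchedCloser y) (length y) ∎
    where
    open ≤-Reasoning
    oᵢ   = occurrences i y (length y)
    oᵢ₊₁ = occurrences (suc i) y (length y)
    balance′ : oᵢ₊₁ + length (stack y (length y)) ≡ oᵢ + countBelow (unmatchedCloser y) (length y)
    balance′ = trans (sym (balance y (length y))) (+-comm _ oᵢ)

  step-++ : ∀ n s e y → (y ≡ suc i → s ≡ [] → e ≡ []) → step n (s ++ e) y ≡ step n s y ++ e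
  step-++ n s e y no-pop-from-e with classify n s y
  ... | opener refl eq = trans (step-opener n (s ++ e)) (cong (_++ e) (sym eq))
  ... | other y≢i y≢1+i eq = trans (step-other n (s ++ e) y y≢i y≢1+i) (cong (_++ e) (sym eq))
  step-++ n []      e y no-pop-from-e | closer refl eq rewrite no-pop-from-e refl refl = sym (++-identityʳ _)
  step-++ n (a ∷ s) e y no-pop-from-e | closer refl eq = trans (step-closer n (a ∷ s ++ e)) (cong (_++ e) (sym eq))

  -- A turned letter opens in x but is an unmatched closer in z, so its position stays at
  -- the bottom of the stack of x as long as no closer of z arrives at an empty stack.
  stack-split : ∀ (x z : List ℕ) (P : ℕ → Bool) →
    (∀ t → P t ≡ true → at x t ≡ i × at z t ≡ suc i) →
    (∀ t → P t ≡ false → at z t ≡ at x t) →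
    (∀ t → stack x t ≡ stack z t ++ positions P t → P t ≡ true → stack z t ≡ []) →
    (∀ t → stack x t ≡ stack z t ++ positions P t → P t ≡ false → at z t ≡ suc i →
           stack z t ≡ [] → positions P t ≡ []) →
    ∀ t → stack x t ≡ stack z t ++ positions P t
  stack-split x z P turned kept z-empty no-pop zero = refl
  stack-split x z P turned kept z-empty no-pop (suc t) with stack-split x z P turned kept z-empty no-pop t
  ... | ih with P t in Pt
  ... | true = begin
      step t (stack x t) (at x t)                 ≡⟨ cong (step t (stack x t)) (proj₁ (turned t Pt)) ⟩
      step t (stack x t) i                        ≡⟨ step-opener t (stack x t) ⟩
      t ∷ stack x t                               ≡⟨ cong (t ∷_) ih ⟩
      t ∷ (stack z t ++ positions P t)            ≡⟨ cong (λ s → t ∷ (s ++ positions P t)) zt≡[] ⟩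
      t ∷ positions P t                           ≡⟨ cong (λ s → pop s ++ t ∷ positions P t) zt≡[] ⟨
      pop (stack z t) ++ t ∷ positions P t        ≡⟨ cong (_++ t ∷ positions P t) (step-closer t (stack z t)) ⟨
      step t (stack z t) (suc i) ++ t ∷ positions P t
                                                  ≡⟨ cong (λ y → step t (stack z t) y ++ t ∷ positions P t) (proj₂ (turned t Pt)) ⟨
      step t (stack z t) (at z t) ++ t ∷ positions P t ∎
    where
    open ≡-Reasoning
    zt≡[] = z-empty t ih Pt
  ... | false rewrite sym (kept t Pt) =
    trans (cong (λ s → step t s (at z t)) ih)
          (step-++ t (stack z t) (positions P t) (at z t) (no-pop t ih Pt))

  module Relabelled (w w′ : List ℕ) (Q : ℕ → Bool)
    (turned : ∀ t → Q t ≡ true → at w t ≡ i × at w′ t ≡ suc i)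
    (kept : ∀ t → Q t ≡ false → at w′ t ≡ at w t) where

    occurrences-opener : ∀ t → occurrences i w′ t + countBelow Q t ≡ occurrences i w t
    occurrences-opener zero = refl
    occurrences-opener (suc t) with Q t in Qt
    ... | true rewrite proj₁ (turned t Qt) | proj₂ (turned t Qt) | dec-true (i ≟ i) refl
                     | dec-false (suc i ≟ i) 1+n≢n = trans (+-suc _ _) (cong suc (occurrences-opener t))
    ... | false rewrite kept t Qt = trans (+-assoc (𝟙 (does (at w t ≟ i))) _ _)
                                          (cong (𝟙 (does (at w t ≟ i)) +_) (occurrences-opener t))

    occurrences-closer : ∀ t → occurrences (suc i) w′ t ≡ occurrences (suc i) w t + countBelow Q t
    occurrences-closer zero = refl
    occurrences-closer (suc t) with Q t in Qt
    ... | true rewrite proj₁ (turned t Qt) | proj₂ (turned t Qt) | dec-true (suc i ≟ suc i) refl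
                     | dec-false (i ≟ suc i) (λ i≡1+i → 1+n≢n (sym i≡1+i)) =
                       trans (cong suc (occurrences-closer t)) (sym (+-suc _ _))
    ... | false rewrite kept t Qt = trans (cong (𝟙 (does (at w t ≟ suc i)) +_) (occurrences-closer t))
                                          (sym (+-assoc (𝟙 (does (at w t ≟ suc i))) _ _))

    occurrences-other : ∀ j → j ≢ i → j ≢ suc i → ∀ t → occurrences j w′ t ≡ occurrences j w t
    occurrences-other j j≢i j≢1+i zero = refl
    occurrences-other j j≢i j≢1+i (suc t) with Q t in Qt
    ... | true rewrite proj₁ (turned t Qt) | proj₂ (turned t Qt) | dec-false (i ≟ j) (λ i≡j → j≢i (sym i≡j))
                     | dec-false (suc i ≟ j) (λ 1+i≡j → j≢1+i (sym 1+i≡j)) = occurrences-other j j≢i j≢1+i t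
    ... | false rewrite kept t Qt = cong (𝟙 (does (at w t ≟ j)) +_) (occurrences-other j j≢i j≢1+i t)

-- The map Θ

module Raising (i d : ℕ) (x : List ℕ) where
  open Matching i

  finalStack : List ℕ
  finalStack = stack x (length x)

  raised : List ℕ
  raised = take d (unmatched i x)

  P : ℕ → Bool
  P = _∈ᵇ raised

  z : List ℕ
  z = Θ i d x

  raised≡ : raised ≡ take d (reverse finalStack)
  raised≡ = cong (take d) (unmatched≡reverse-stack x)

  P⇒∈finalStack : ∀ {t} → P t ≡ true → t ∈ finalStack
  P⇒∈finalStack {t} Pt =
    Any.reverse⁻ (∈-take⁻ d (reverse finalStack) (subst (t ∈_) raised≡ (∈ᵇ⇒∈ t raised Pt)))

  P⇒< : ∀ {t} → P t ≡ true → t < length x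
  P⇒< Pt = proj₁ (∈-stack⁻ x (length x) (P⇒∈finalStack Pt))

  P⇒opener : ∀ {t} → P t ≡ true → at x t ≡ i
  P⇒opener Pt = proj₂ (∈-stack⁻ x (length x) (P⇒∈finalStack Pt))

  length-z : length z ≡ length x
  length-z = trans (cong length (replaceAt≡relabel raised (suc i) 0 x)) (length-relabel P (suc i) 0 x)

  at-z : ∀ t → at z t ≡ (if P t then suc i else at x t)
  at-z t = trans (cong (λ w → at w t) (replaceAt≡relabel raised (suc i) 0 x)) (at-relabel P (suc i) x P⇒< t)

  P⇒closer : ∀ {t} → P t ≡ true → at z t ≡ suc i
  P⇒closer {t} Pt = trans (at-z t) (cong (λ b → if b then suc i else at x t) Pt)

  turned : ∀ t → P t ≡ true → at x t ≡ i × at z t ≡ suc i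
  turned t Pt = P⇒opener Pt , P⇒closer Pt

  kept : ∀ t → P t ≡ false → at z t ≡ at x t
  kept t ¬Pt = trans (at-z t) (cong (λ b → if b then suc i else at x t) ¬Pt)

  P-downClosed : ∀ {p q} → P p ≡ true → q ∈ finalStack → q < p → P q ≡ true
  P-downClosed {p} {q} Pp q∈ q<p =
    ∈⇒∈ᵇ q raised (subst (q ∈_) (sym raised≡)
      (take-downClosed d (reverse-descending (stack-descending x (length x)))
        (subst (p ∈_) raised≡ (∈ᵇ⇒∈ p raised Pp)) (Any.reverse⁺ q∈) q<p))

  ∈-stack-at-P⇒∈finalStack : ∀ {t q} → P t ≡ true → q ∈ stack x t → q ∈ finalStack
  ∈-stack-at-P⇒∈finalStack {t} {q} Pt q∈ =
    subst (λ m → q ∈ stack x m) (m+[n∸m]≡n (P⇒< Pt))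
      (under-opener-persists x t (length x ∸ suc t)
        (subst (λ m → t ∈ stack x m) (sym (m+[n∸m]≡n (P⇒< Pt))) (P⇒∈finalStack Pt)) q∈)

  z-empty : ∀ t → stack x t ≡ stack z t ++ positions P t → P t ≡ true → stack z t ≡ []
  z-empty t split Pt with stack z t
  ... | [] = refl
  ... | q ∷ s = ⊥-elim (descending-disjoint (q ∷ s) (subst Descending split (stack-descending x t))
                                            (here refl) (∈-positions⁺ P t q<t Pq))
    where
    q∈x : q ∈ stack x t
    q∈x = subst (q ∈_) (sym split) (here refl)
    q<t = proj₁ (∈-stack⁻ x t q∈x)
    Pq = P-downClosed Pt (∈-stack-at-P⇒∈finalStack Pt q∈x) q<t

  no-pop : ∀ t → stack x t ≡ stack z t ++ positions P t → P t ≡ false → at z t ≡ suc i →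
           stack z t ≡ [] → positions P t ≡ []
  no-pop t split ¬Pt zt≡1+i zt-empty with positions P t in Pt≡
  ... | [] = refl
  ... | e ∷ rest = ⊥-elim (descending-head∉ (subst Descending xt≡ (stack-descending x t))
                                             (subst (e ∈_) popped e∈))
    where
    xt≡ : stack x t ≡ e ∷ rest
    xt≡ = trans split (cong (_++ e ∷ rest) zt-empty)
    popped : stack x (suc t) ≡ rest
    popped = trans (cong (step t (stack x t)) (trans (sym (kept t ¬Pt)) zt≡1+i))
                   (trans (step-closer t (stack x t)) (cong pop xt≡))
    e-marked : e < t × P e ≡ true
    e-marked = ∈-positions⁻ P t (subst (e ∈_) (sym Pt≡) (here refl))
    t<len = subst (t <_) length-z (at≡suc⇒< z t zt≡1+i)
    e∈ : e ∈ stack x (suc t)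
    e∈ = ∈-stack-later⇒∈-stack x (suc t) (length x ∸ suc t)
           (subst (λ m → e ∈ stack x m) (sym (m+[n∸m]≡n t<len)) (P⇒∈finalStack (proj₂ e-marked)))
           (m<n⇒m<1+n (proj₁ e-marked))

  split : ∀ t → stack x t ≡ stack z t ++ positions P t
  split = stack-split x z P turned kept z-empty no-pop

  stack-z-unmarked : ∀ t {q} → q ∈ stack z t → P q ≡ false
  stack-z-unmarked t {q} q∈ with P q in Pq
  ... | false = refl
  ... | true  = ⊥-elim (descending-disjoint (stack z t) (subst Descending (split t) (stack-descending x t))
                                            q∈ (∈-positions⁺ P t q<t Pq))
    where q<t = proj₁ (∈-stack⁻ x t (subst (q ∈_) (sym (split t)) (∈-++⁺ˡ q∈)))

  countBelow-P≡d : d ≤ length (unmatched i x) → countBelow P (length x) ≡ d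
  countBelow-P≡d d≤ = begin
    countBelow P (length x)           ≡⟨ length-positions P (length x) ⟨
    length (positions P (length x))   ≡⟨ length-reverse (positions P (length x)) ⟨
    length A                          ≡⟨ length-of-take-prefix d A B AB↑ (subst (λ u → d ≤ length u) unmatched≡AB d≤)
                                                                 A⊆raised B∩raised≡∅ ⟩
    d                                 ∎
    where
    open ≡-Reasoning
    A = reverse (positions P (length x))
    B = reverse (stack z (length x))
    finalStack≡AB : reverse finalStack ≡ A ++ B
    finalStack≡AB = trans (cong reverse (split (length x))) (reverse-++ (stack z (length x)) (positions P (length x)))
    unmatched≡AB : unmatched i x ≡ A ++ B
    unmatched≡AB = trans (unmatched≡reverse-stack x) finalStack≡AB
    AB↑ : Ascending (A ++ B)
    AB↑ = subst Ascending finalStack≡AB (reverse-descending (stack-descending x (length x)))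
    A⊆raised : ∀ {a} → a ∈ A → a ∈ take d (A ++ B)
    A⊆raised {a} a∈ = subst (a ∈_) (cong (take d) unmatched≡AB)
      (∈ᵇ⇒∈ a raised (proj₂ (∈-positions⁻ P (length x) (Any.reverse⁻ a∈))))
    B∩raised≡∅ : ∀ {b} → b ∈ B → ¬ b ∈ take d (A ++ B)
    B∩raised≡∅ {b} b∈ b∈raised = false≢true (trans (sym (stack-z-unmarked (length x) (Any.reverse⁻ b∈)))
      (∈⇒∈ᵇ b raised (subst (b ∈_) (sym (cong (take d) unmatched≡AB)) b∈raised)))

  unmarked-opener-between : ∀ {p r} → P p ≡ true → p < r → at x r ≡ suc i →
                            ∃ λ q → p < q × q < r × at x q ≡ i × P q ≡ false
  unmarked-opener-between {p} {r} Pp p<r xr≡1+i with P r in Pr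
  ... | true  = ⊥-elim (1+n≢n (trans (sym xr≡1+i) (P⇒opener Pr)))
  ... | false with stack z r in zr
  ...   | [] = ⊥-elim (Any.¬Any[] (subst (p ∈_) (no-pop r (split r) Pr (trans (kept r Pr) xr≡1+i) zr)
                                         (∈-positions⁺ P r p<r Pp)))
  ...   | q ∷ s = q , p<q , proj₁ q-opener , proj₂ q-opener , stack-z-unmarked r (subst (q ∈_) (sym zr) (here refl))
    where
    xr≡ : stack x r ≡ q ∷ (s ++ positions P r)
    xr≡ = trans (split r) (cong (_++ positions P r) zr)
    q-opener : q < r × at x q ≡ i
    q-opener = ∈-stack⁻ x r (subst (q ∈_) (sym xr≡) (here refl))
    p<q : p < q
    p<q with subst Descending xr≡ (stack-descending x r)
    ... | q>rest ∷ _ = All.lookup q>rest (∈-++⁺ʳ s (∈-positions⁺ P r p<r Pp))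

  closer-between : ∀ {p q} → P p ≡ true → q < p → at x q ≡ i → P q ≡ false →
                   ∃ λ r → q < r × r < p × at x r ≡ suc i
  closer-between {p} {q} Pp q<p xq≡i ¬Pq = popped⇒closer x q p pushed popped q<p
    where
    pushed : q ∈ stack x (suc q)
    pushed = subst (q ∈_) (sym (trans (cong (step q (stack x q)) xq≡i) (step-opener q (stack x q)))) (here refl)
    popped : ¬ q ∈ stack x p
    popped q∈ = false≢true (trans (sym ¬Pq) (P-downClosed Pp (∈-stack-at-P⇒∈finalStack Pp q∈) q<p))

  module _ (d≤ : d ≤ length (unmatched i x)) where
    open Relabelled x z P turned kept

    count-z-opener : count i z + d ≡ count i x
    count-z-opener = begin
      count i z + d                                           ≡⟨ cong₂ _+_ (count≡occurrences i z) (sym (countBelow-P≡d d≤)) ⟩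
      occurrences i z (length z) + countBelow P (length x)    ≡⟨ cong (λ n → occurrences i z n + countBelow P (length x)) length-z ⟩
      occurrences i z (length x) + countBelow P (length x)    ≡⟨ occurrences-opener (length x) ⟩
      occurrences i x (length x)                              ≡⟨ count≡occurrences i x ⟨
      count i x                                               ∎
      where open ≡-Reasoning

    count-z-closer : count (suc i) z ≡ count (suc i) x + d
    count-z-closer = begin
      count (suc i) z                                                ≡⟨ count≡occurrences (suc i) z ⟩
      occurrences (suc i) z (length z)                               ≡⟨ cong (occurrences (suc i) z) length-z ⟩
      occurrences (suc i) z (length x)                               ≡⟨ occurrences-closer (length x) ⟩
      occurrences (suc i) x (length x) + countBelow P (length x)     ≡⟨ cong₂ _+_ (sym (count≡occurrences (suc i) x)) (countBelow-P≡d d≤) ⟩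
      count (suc i) x + d                                            ∎
      where open ≡-Reasoning

  count-z-other : ∀ j → j ≢ i → j ≢ suc i → count j z ≡ count j x
  count-z-other j j≢i j≢1+i = begin
    count j z                  ≡⟨ count≡occurrences j z ⟩
    occurrences j z (length z) ≡⟨ cong (occurrences j z) length-z ⟩
    occurrences j z (length x) ≡⟨ Relabelled.occurrences-other x z P turned kept j j≢i j≢1+i (length x) ⟩
    occurrences j x (length x) ≡⟨ count≡occurrences j x ⟨
    count j x                  ∎
    where open ≡-Reasoning

  private
    triple-z : ∀ {s₁ s₂ s₃} → s₁ < s₂ → s₂ < s₃ → s₃ < length x →
             at z s₁ < at z s₂ → at z s₂ < at z s₃ → Contains123ᵢ z
    triple-z s₁<s₂ s₂<s₃ s₃<len z₁<z₂ z₂<z₃ =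
      _ , _ , _ , s₁<s₂ , s₂<s₃ , subst (_ <_) (sym length-z) s₃<len , z₁<z₂ , z₂<z₃

    triple-x : ∀ {s₁ s₂ s₃} → s₁ < s₂ → s₂ < s₃ → s₃ < length z →
               at x s₁ < at x s₂ → at x s₂ < at x s₃ → Contains123ᵢ x
    triple-x s₁<s₂ s₂<s₃ s₃<len x₁<x₂ x₂<x₃ =
      _ , _ , _ , s₁<s₂ , s₂<s₃ , subst (_ <_) length-z s₃<len , x₁<x₂ , x₂<x₃

  Θ-preserves-123 : Contains123ᵢ x → Contains123ᵢ z
  Θ-preserves-123 (t₁ , t₂ , t₃ , t₁<t₂ , t₂<t₃ , t₃<len , x₁<x₂ , x₂<x₃)
    with P t₁ in P₁ | P t₂ in P₂ | P t₃ in P₃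
  ... | true  | true  | _     = ⊥-elim (<-irrefl (trans (P⇒opener P₁) (sym (P⇒opener P₂))) x₁<x₂)
  ... | _     | true  | true  = ⊥-elim (<-irrefl (trans (P⇒opener P₂) (sym (P⇒opener P₃))) x₂<x₃)
  ... | true  | false | true  = ⊥-elim (<-irrefl (trans (P⇒opener P₁) (sym (P⇒opener P₃))) (<-trans x₁<x₂ x₂<x₃))
  ... | false | false | false =
    triple-z t₁<t₂ t₂<t₃ t₃<len (subst₂ _<_ (sym (kept t₁ P₁)) (sym (kept t₂ P₂)) x₁<x₂)
                              (subst₂ _<_ (sym (kept t₂ P₂)) (sym (kept t₃ P₃)) x₂<x₃)
  ... | false | false | true  =
    triple-z t₁<t₂ t₂<t₃ t₃<len (subst₂ _<_ (sym (kept t₁ P₁)) (sym (kept t₂ P₂)) x₁<x₂)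
      (subst₂ _<_ (sym (kept t₂ P₂)) (sym (P⇒closer P₃)) (m<n⇒m<1+n (subst (at x t₂ <_) (P⇒opener P₃) x₂<x₃)))
  ... | false | true  | false with at x t₃ ≟ suc i
  ...   | no x₃≢1+i =
    triple-z t₁<t₂ t₂<t₃ t₃<len
      (subst₂ _<_ (sym (kept t₁ P₁)) (sym (P⇒closer P₂)) (m<n⇒m<1+n (subst (at x t₁ <_) (P⇒opener P₂) x₁<x₂)))
      (subst₂ _<_ (sym (P⇒closer P₂)) (sym (kept t₃ P₃))
        (≤∧≢⇒< (subst (_< at x t₃) (P⇒opener P₂) x₂<x₃) (λ 1+i≡x₃ → x₃≢1+i (sym 1+i≡x₃))))
  ...   | yes x₃≡1+i with unmarked-opener-between P₂ t₂<t₃ x₃≡1+i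
  ...     | q , t₂<q , q<t₃ , xq≡i , ¬Pq =
    triple-z (<-trans t₁<t₂ t₂<q) q<t₃ t₃<len
      (subst₂ _<_ (sym (kept t₁ P₁)) (sym (trans (kept q ¬Pq) xq≡i)) (subst (at x t₁ <_) (P⇒opener P₂) x₁<x₂))
      (subst₂ _<_ (sym (trans (kept q ¬Pq) xq≡i)) (sym (trans (kept t₃ P₃) x₃≡1+i)) (n<1+n i))
  Θ-preserves-123 (t₁ , t₂ , t₃ , t₁<t₂ , t₂<t₃ , t₃<len , x₁<x₂ , x₂<x₃)
    | true | false | false with at x t₂ ≟ suc i
  ...   | no x₂≢1+i =
    triple-z t₁<t₂ t₂<t₃ t₃<len
      (subst₂ _<_ (sym (P⇒closer P₁)) (sym (kept t₂ P₂))
        (≤∧≢⇒< (subst (_< at x t₂) (P⇒opener P₁) x₁<x₂) (λ 1+i≡x₂ → x₂≢1+i (sym 1+i≡x₂))))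
      (subst₂ _<_ (sym (kept t₂ P₂)) (sym (kept t₃ P₃)) x₂<x₃)
  ...   | yes x₂≡1+i with unmarked-opener-between P₁ t₁<t₂ x₂≡1+i
  ...     | q , t₁<q , q<t₂ , xq≡i , ¬Pq =
    triple-z q<t₂ t₂<t₃ t₃<len
      (subst₂ _<_ (sym (trans (kept q ¬Pq) xq≡i)) (sym (trans (kept t₂ P₂) x₂≡1+i)) (n<1+n i))
      (subst₂ _<_ (sym (kept t₂ P₂)) (sym (kept t₃ P₃)) x₂<x₃)

  Θ-reflects-123 : Contains123ᵢ z → Contains123ᵢ x
  Θ-reflects-123 (t₁ , t₂ , t₃ , t₁<t₂ , t₂<t₃ , t₃<len , z₁<z₂ , z₂<z₃)
    with P t₁ in P₁ | P t₂ in P₂ | P t₃ in P₃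
  ... | true  | true  | _     = ⊥-elim (<-irrefl (trans (P⇒closer P₁) (sym (P⇒closer P₂))) z₁<z₂)
  ... | _     | true  | true  = ⊥-elim (<-irrefl (trans (P⇒closer P₂) (sym (P⇒closer P₃))) z₂<z₃)
  ... | true  | false | true  = ⊥-elim (<-irrefl (trans (P⇒closer P₁) (sym (P⇒closer P₃))) (<-trans z₁<z₂ z₂<z₃))
  ... | false | false | false =
    triple-x t₁<t₂ t₂<t₃ t₃<len (subst₂ _<_ (kept t₁ P₁) (kept t₂ P₂) z₁<z₂) (subst₂ _<_ (kept t₂ P₂) (kept t₃ P₃) z₂<z₃)
  ... | true  | false | false =
    triple-x t₁<t₂ t₂<t₃ t₃<len
      (subst₂ _<_ (sym (P⇒opener P₁)) (kept t₂ P₂) (<-trans (n<1+n i) (subst (_< at z t₂) (P⇒closer P₁) z₁<z₂)))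
      (subst₂ _<_ (kept t₂ P₂) (kept t₃ P₃) z₂<z₃)
  ... | false | false | true with at x t₂ ≟ i
  ...   | no x₂≢i =
    triple-x t₁<t₂ t₂<t₃ t₃<len (subst₂ _<_ (kept t₁ P₁) (kept t₂ P₂) z₁<z₂)
      (subst (at x t₂ <_) (sym (P⇒opener P₃))
        (≤∧≢⇒< (s≤s⁻¹ (subst₂ _<_ (kept t₂ P₂) (P⇒closer P₃) z₂<z₃)) x₂≢i))
  ...   | yes x₂≡i with closer-between P₃ t₂<t₃ x₂≡i P₂
  ...     | r , t₂<r , r<t₃ , xr≡1+i =
    triple-x t₁<t₂ t₂<r (<-trans r<t₃ t₃<len) (subst₂ _<_ (kept t₁ P₁) (kept t₂ P₂) z₁<z₂)
      (subst₂ _<_ (sym x₂≡i) (sym xr≡1+i) (n<1+n i))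
  Θ-reflects-123 (t₁ , t₂ , t₃ , t₁<t₂ , t₂<t₃ , t₃<len , z₁<z₂ , z₂<z₃)
    | false | true | false with at x t₁ ≟ i
  ...   | no x₁≢i =
    triple-x t₁<t₂ t₂<t₃ t₃<len
      (subst (at x t₁ <_) (sym (P⇒opener P₂))
        (≤∧≢⇒< (s≤s⁻¹ (subst₂ _<_ (kept t₁ P₁) (P⇒closer P₂) z₁<z₂)) x₁≢i))
      (subst₂ _<_ (sym (P⇒opener P₂)) (kept t₃ P₃) (<-trans (n<1+n i) (subst (_< at z t₃) (P⇒closer P₂) z₂<z₃)))
  ...   | yes x₁≡i with closer-between P₂ t₁<t₂ x₁≡i P₁
  ...     | r , t₁<r , r<t₂ , xr≡1+i =
    triple-x t₁<r (<-trans r<t₂ t₂<t₃) t₃<len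
      (subst₂ _<_ (sym x₁≡i) (sym xr≡1+i) (n<1+n i))
      (subst₂ _<_ (sym xr≡1+i) (kept t₃ P₃) (subst (_< at z t₃) (P⇒closer P₂) z₂<z₃))

module EqualImages (i d : ℕ) (x y : List ℕ) (Θx≡Θy : Θ i d x ≡ Θ i d y)
                   (d≤x : d ≤ length (unmatched i x)) (d≤y : d ≤ length (unmatched i y)) where
  private
    module X = Raising i d x
    module Y = Raising i d y

  length≡ : length x ≡ length y
  length≡ = trans (sym X.length-z) (trans (cong length Θx≡Θy) Y.length-z)

  -- At a mark of x the common image has an unmatched closer on an empty stack, so no
  -- earlier mark of y may be pending there (and symmetrically for later marks of y).
  marks-⊆ : ∀ {t} → X.P t ≡ true → Y.P t ≡ false → ∀ {q} → Y.P q ≡ true → X.P q ≡ true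
  marks-⊆ {t} Xt ¬Yt {q} Yq with q <? t
  ... | yes q<t = ⊥-elim (Any.¬Any[] (subst (q ∈_) no-Y-marks-before-t (∈-positions⁺ Y.P t q<t Yq)))
    where
    no-Y-marks-before-t : positions Y.P t ≡ []
    no-Y-marks-before-t = Y.no-pop t (Y.split t) ¬Yt
      (trans (cong (λ w → at w t) (sym Θx≡Θy)) (X.P⇒closer Xt))
      (trans (cong (λ w → Matching.stack i w t) (sym Θx≡Θy)) (X.z-empty t (X.split t) Xt))
  ... | no q≮t with q ≟ t
  ...   | yes refl = ⊥-elim (false≢true (trans (sym ¬Yt) Yq))
  ...   | no  q≢t with X.P q in Xq
  ...     | true  = refl
  ...     | false = ⊥-elim (Any.¬Any[] (subst (t ∈_) no-X-marks-before-q (∈-positions⁺ X.P q t<q Xt)))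
    where
    t<q = ≤∧≢⇒< (≮⇒≥ q≮t) (λ t≡q → q≢t (sym t≡q))
    no-X-marks-before-q : positions X.P q ≡ []
    no-X-marks-before-q = X.no-pop q (X.split q) Xq
      (trans (cong (λ w → at w q) Θx≡Θy) (Y.P⇒closer Yq))
      (trans (cong (λ w → Matching.stack i w q) Θx≡Θy) (Y.z-empty q (Y.split q) Yq))

  no-extra-mark : ∀ {t} → X.P t ≡ true → Y.P t ≡ false → ⊥
  no-extra-mark Xt ¬Yt = <-irrefl same-count (countBelow-⊂ Y.P X.P (marks-⊆ Xt ¬Yt) (X.P⇒< Xt) Xt ¬Yt)
    where
    same-count : countBelow Y.P (length x) ≡ countBelow X.P (length x)
    same-count = trans (cong (countBelow Y.P) length≡)
                       (trans (Y.countBelow-P≡d d≤y) (sym (X.countBelow-P≡d d≤x)))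

Θ-injective : ∀ i d {x y} → d ≤ length (unmatched i x) → d ≤ length (unmatched i y) →
              Θ i d x ≡ Θ i d y → x ≡ y
Θ-injective i d {x} {y} d≤x d≤y Θx≡Θy = at-ext x y XY.length≡ same-letter
  where
  module X  = Raising i d x
  module Y  = Raising i d y
  module XY = EqualImages i d x y Θx≡Θy d≤x d≤y
  module YX = EqualImages i d y x (sym Θx≡Θy) d≤y d≤x
  same-letter : ∀ t → t < length x → at x t ≡ at y t
  same-letter t _ with X.P t in Xt | Y.P t in Yt
  ... | true  | true  = trans (X.P⇒opener Xt) (sym (Y.P⇒opener Yt))
  ... | false | false = trans (sym (X.kept t Xt)) (trans (cong (λ w → at w t) Θx≡Θy) (Y.kept t Yt))
  ... | true  | false = ⊥-elim (XY.no-extra-mark Xt Yt)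
  ... | false | true  = ⊥-elim (YX.no-extra-mark Yt Xt)

-- Inverting Θ

module Lowering (i d : ℕ) (y : List ℕ) where
  open Matching i

  U : ℕ → Bool
  U = unmatchedCloser y

  m₀ : ℕ
  m₀ = countBelow U (length y) ∸ d

  -- P marks the last d unmatched closers of y: those preceded by at least m₀ others.
  P : ℕ → Bool
  P t = U t ∧ does (m₀ ≤? countBelow U t)

  x : List ℕ
  x = relabel P i 0 y

  P⇒closer : ∀ {t} → P t ≡ true → at y t ≡ suc i
  P⇒closer {t} Pt = does≡true⇒ (at y t ≟ suc i) (∧-conicalˡ _ _ (∧-conicalˡ _ _ Pt))

  P⇒empty : ∀ {t} → P t ≡ true → stack y t ≡ []
  P⇒empty {t} Pt = null≡true⇒≡[] (stack y t) (∧-conicalʳ (does (at y t ≟ suc i)) _ (∧-conicalˡ _ _ Pt))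

  P⇒late : ∀ {t} → P t ≡ true → m₀ ≤ countBelow U t
  P⇒late {t} Pt = does≡true⇒ (m₀ ≤? countBelow U t) (∧-conicalʳ _ _ Pt)

  P⇒< : ∀ {t} → P t ≡ true → t < length y
  P⇒< {t} Pt = at≡suc⇒< y t (P⇒closer Pt)

  length-x : length x ≡ length y
  length-x = length-relabel P i 0 y

  at-x : ∀ t → at x t ≡ (if P t then i else at y t)
  at-x = at-relabel P i y P⇒<

  turned : ∀ t → P t ≡ true → at x t ≡ i × at y t ≡ suc i
  turned t Pt = trans (at-x t) (cong (λ b → if b then i else at y t) Pt) , P⇒closer Pt

  kept : ∀ t → P t ≡ false → at y t ≡ at x t
  kept t ¬Pt = sym (trans (at-x t) (cong (λ b → if b then i else at y t) ¬Pt))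

  no-pop : ∀ t → stack x t ≡ stack y t ++ positions P t → P t ≡ false → at y t ≡ suc i →
           stack y t ≡ [] → positions P t ≡ []
  no-pop t _ ¬Pt yt≡1+i yt-empty with positions P t in Pt≡
  ... | [] = refl
  ... | e ∷ _ = ⊥-elim (<-irrefl refl (≤-<-trans (P⇒late Pe) (<-trans (countBelow-strict U (∧-conicalˡ _ _ Pe) e<t) early)))
    where
    Ut : U t ≡ true
    Ut = cong₂ _∧_ (dec-true (at y t ≟ suc i) yt≡1+i) (cong null yt-empty)
    early : countBelow U t < m₀
    early = ≰⇒> (does≡false⇒ (m₀ ≤? countBelow U t) (subst (λ b → b ∧ does (m₀ ≤? countBelow U t) ≡ false) Ut ¬Pt))
    e-marked : e < t × P e ≡ true
    e-marked = ∈-positions⁻ P t (subst (e ∈_) (sym Pt≡) (here refl))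
    e<t = proj₁ e-marked
    Pe = proj₂ e-marked

  split : ∀ t → stack x t ≡ stack y t ++ positions P t
  split = stack-split x y P turned kept (λ t _ Pt → P⇒empty Pt) no-pop

  countBelow-P : ∀ t → countBelow P t ≡ countBelow U t ∸ m₀
  countBelow-P zero = sym (0∸n≡0 m₀)
  countBelow-P (suc t) with U t
  ... | false = countBelow-P t
  ... | true with does (m₀ ≤? countBelow U t) in late?
  ...   | true  = trans (cong suc (countBelow-P t)) (sym (+-∸-assoc 1 (does≡true⇒ (m₀ ≤? countBelow U t) late?)))
  ...   | false = trans (countBelow-P t) (trans (m≤n⇒m∸n≡0 (<⇒≤ early)) (sym (m≤n⇒m∸n≡0 early)))
    where early = ≰⇒> (does≡false⇒ (m₀ ≤? countBelow U t) late?)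

  countBelow-P≡d : d ≤ countBelow U (length y) → countBelow P (length y) ≡ d
  countBelow-P≡d d≤N = trans (countBelow-P (length y)) (m∸[m∸n]≡n d≤N)

  module _ (d≤N : d ≤ countBelow U (length y)) where

    raised≡ : take d (unmatched i x) ≡ reverse (positions P (length y))
    raised≡ = begin
      take d (unmatched i x)                                ≡⟨ cong (take d) unmatched-x≡ ⟩
      take d (A ++ B)                                       ≡⟨ cong (λ k → take k (A ++ B)) length-A ⟨
      take (length A) (A ++ B)                              ≡⟨ take-length-++ A B ⟩
      A                                                     ∎
      where
      open ≡-Reasoning
      A = reverse (positions P (length y))
      B = reverse (stack y (length y))
      unmatched-x≡ : unmatched i x ≡ A ++ B
      unmatched-x≡ = trans (unmatched≡reverse-stack x)
        (trans (cong (λ m → reverse (stack x m)) length-x)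
          (trans (cong reverse (split (length y))) (reverse-++ (stack y (length y)) (positions P (length y)))))
      length-A : length A ≡ d
      length-A = trans (length-reverse (positions P (length y))) (trans (length-positions P (length y)) (countBelow-P≡d d≤N))

    raised-marks-P : ∀ t → t ∈ᵇ take d (unmatched i x) ≡ P t
    raised-marks-P t rewrite raised≡ with P t in Pt
    ... | true = ∈⇒∈ᵇ t _ (Any.reverse⁺ (∈-positions⁺ P (length y) (P⇒< Pt) Pt))
    ... | false with t ∈ᵇ reverse (positions P (length y)) in t∈?
    ...   | false = refl
    ...   | true  = sym (trans (sym Pt)
                      (proj₂ (∈-positions⁻ P (length y) (Any.reverse⁻ (∈ᵇ⇒∈ t _ t∈?)))))

    Θ-x≡y : Θ i d x ≡ y
    Θ-x≡y = at-ext (Θ i d x) y (trans F.length-z length-x) (λ t _ → trans (F.at-z t) (agree t))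
      where
      module F = Raising i d x
      agree : ∀ t → (if F.P t then suc i else at x t) ≡ at y t
      agree t rewrite raised-marks-P t with P t in Pt
      ... | true  = sym (P⇒closer Pt)
      ... | false = sym (kept t Pt)

    count-x-opener : count i y + d ≡ count i x
    count-x-opener = begin
      count i y + d                                            ≡⟨ cong₂ _+_ (count≡occurrences i y) (sym (countBelow-P≡d d≤N)) ⟩
      occurrences i y (length y) + countBelow P (length y)     ≡⟨ Relabelled.occurrences-opener x y P turned kept (length y) ⟩
      occurrences i x (length y)                               ≡⟨ cong (occurrences i x) length-x ⟨
      occurrences i x (length x)                               ≡⟨ count≡occurrences i x ⟨
      count i x                                                ∎
      where open ≡-Reasoning

    count-x-closer : count (suc i) y ≡ count (suc i) x + d
    count-x-closer = begin
      count (suc i) y                                               ≡⟨ count≡occurrences (suc i) y ⟩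
      occurrences (suc i) y (length y)                              ≡⟨ Relabelled.occurrences-closer x y P turned kept (length y) ⟩
      occurrences (suc i) x (length y) + countBelow P (length y)    ≡⟨ cong (λ n → occurrences (suc i) x n + countBelow P (length y)) length-x ⟨
      occurrences (suc i) x (length x) + countBelow P (length y)    ≡⟨ cong₂ _+_ (sym (count≡occurrences (suc i) x)) (countBelow-P≡d d≤N) ⟩
      count (suc i) x + d                                           ∎
      where open ≡-Reasoning

  count-x-other : ∀ j → j ≢ i → j ≢ suc i → count j x ≡ count j y
  count-x-other j j≢i j≢1+i = begin
    count j x                  ≡⟨ count≡occurrences j x ⟩
    occurrences j x (length x) ≡⟨ cong (occurrences j x) length-x ⟩
    occurrences j x (length y) ≡⟨ Relabelled.occurrences-other x y P turned kept j j≢i j≢1+i (length y) ⟨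
    occurrences j y (length y) ≡⟨ count≡occurrences j y ⟨
    count j y                  ∎
    where open ≡-Reasoning

swapAt-i : ∀ i a → swapAt i a i ≡ a (suc i)
swapAt-i i a rewrite dec-true (i ≟ i) refl = refl

swapAt-suc-i : ∀ i a → swapAt i a (suc i) ≡ a i
swapAt-suc-i i a rewrite dec-false (suc i ≟ i) 1+n≢n | dec-true (suc i ≟ suc i) refl = refl

swapAt-other : ∀ i a j → j ≢ i → j ≢ suc i → swapAt i a j ≡ a j
swapAt-other i a j j≢i j≢1+i rewrite dec-false (j ≟ i) j≢i | dec-false (j ≟ suc i) j≢1+i = refl

m+n≡o⇒m≡o∸n : ∀ {m n o} → m + n ≡ o → m ≡ o ∸ n
m+n≡o⇒m≡o∸n {m} {n} eq = trans (sym (m+n∸n≡m m n)) (cong (_∸ n) eq)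

module _ {k : ℕ} {a : ℕ → ℕ} {i : ℕ} (1≤i : 1 ≤ i) (i<k : i < k) (aᵢ₊₁≤aᵢ : a (suc i) ≤ a i) where
  private
    d : ℕ
    d = a i ∸ a (suc i)
    b : ℕ → ℕ
    b = swapAt i a
    i≤k : i ≤ k
    i≤k = <⇒≤ i<k
    1≤1+i : 1 ≤ suc i
    1≤1+i = s≤s z≤n

  perm⇒d≤unmatched : ∀ {x} → IsPermOf k a x → d ≤ length (unmatched i x)
  perm⇒d≤unmatched {x} (_ , count≡) =
    subst₂ (λ m n → m ∸ n ≤ length (unmatched i x)) (count≡ i 1≤i i≤k) (count≡ (suc i) 1≤1+i i<k)
      (Matching.count-∸-count≤unmatched i x)

  Θ-IsPermOf : ∀ {x} → IsPermOf k a x → IsPermOf k b (Θ i d x)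
  Θ-IsPermOf {x} x∈M@(letters , count≡) = letters′ , count≡′
    where
    open Raising i d x
    d≤ = perm⇒d≤unmatched x∈M
    letters′ : ∀ {y} → y ∈ z → 1 ≤ y × y ≤ k
    letters′ y∈ with ∈-relabel⁻ P (suc i) 0 x (subst (_ ∈_) (replaceAt≡relabel raised (suc i) 0 x) y∈)
    ... | inj₁ refl = 1≤1+i , i<k
    ... | inj₂ y∈x  = letters y∈x
    count≡′ : ∀ j → 1 ≤ j → j ≤ k → count j z ≡ b j
    count≡′ j 1≤j j≤k with j ≟ i | j ≟ suc i
    ... | yes refl | _ = begin
      count i z                 ≡⟨ m+n≡o⇒m≡o∸n (trans (count-z-opener d≤) (count≡ i 1≤j j≤k)) ⟩
      a i ∸ d                   ≡⟨ m∸[m∸n]≡n aᵢ₊₁≤aᵢ ⟩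
      a (suc i)                 ≡⟨ swapAt-i i a ⟨
      b i                       ∎
      where open ≡-Reasoning
    ... | no _ | yes refl = begin
      count (suc i) z           ≡⟨ count-z-closer d≤ ⟩
      count (suc i) x + d       ≡⟨ cong (_+ d) (count≡ (suc i) 1≤j j≤k) ⟩
      a (suc i) + d             ≡⟨ m+[n∸m]≡n aᵢ₊₁≤aᵢ ⟩
      a i                       ≡⟨ swapAt-suc-i i a ⟨
      b (suc i)                 ∎
      where open ≡-Reasoning
    ... | no j≢i | no j≢1+i =
      trans (count-z-other j j≢i j≢1+i) (trans (count≡ j 1≤j j≤k) (sym (swapAt-other i a j j≢i j≢1+i)))

  Θ-injective-on-perms : ∀ {x y} → IsPermOf k a x → IsPermOf k a y → Θ i d x ≡ Θ i d y → x ≡ y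
  Θ-injective-on-perms x∈M y∈M = Θ-injective i d (perm⇒d≤unmatched x∈M) (perm⇒d≤unmatched y∈M)

  Θ-surjective-on-perms : ∀ {y} → IsPermOf k b y → ∃ λ x → IsPermOf k a x × Θ i d x ≡ y
  Θ-surjective-on-perms {y} (letters , count≡) = x , (letters′ , count≡′) , Θ-x≡y d≤N
    where
    open Lowering i d y
    d≤N : d ≤ countBelow U (length y)
    d≤N = subst₂ (λ m n → m ∸ n ≤ countBelow U (length y))
            (trans (count≡ (suc i) 1≤1+i i<k) (swapAt-suc-i i a)) (trans (count≡ i 1≤i i≤k) (swapAt-i i a))
            (Matching.count-∸-count≤unmatchedClosers i y)
    letters′ : ∀ {c} → c ∈ x → 1 ≤ c × c ≤ k
    letters′ c∈ with ∈-relabel⁻ P i 0 y c∈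
    ... | inj₁ refl = 1≤i , i≤k
    ... | inj₂ c∈y  = letters c∈y
    count≡′ : ∀ j → 1 ≤ j → j ≤ k → count j x ≡ a j
    count≡′ j 1≤j j≤k with j ≟ i | j ≟ suc i
    ... | yes refl | _ = begin
      count i x                 ≡⟨ count-x-opener d≤N ⟨
      count i y + d             ≡⟨ cong (_+ d) (trans (count≡ i 1≤j j≤k) (swapAt-i i a)) ⟩
      a (suc i) + d             ≡⟨ m+[n∸m]≡n aᵢ₊₁≤aᵢ ⟩
      a i                       ∎
      where open ≡-Reasoning
    ... | no _ | yes refl = begin
      count (suc i) x           ≡⟨ m+n≡o⇒m≡o∸n (sym (count-x-closer d≤N)) ⟩
      count (suc i) y ∸ d       ≡⟨ cong (_∸ d) (trans (count≡ (suc i) 1≤j j≤k) (swapAt-suc-i i a)) ⟩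
      a i ∸ d                   ≡⟨ m∸[m∸n]≡n aᵢ₊₁≤aᵢ ⟩
      a (suc i)                 ∎
      where open ≡-Reasoning
    ... | no j≢i | no j≢1+i =
      trans (count-x-other j j≢i j≢1+i) (trans (count≡ j 1≤j j≤k) (swapAt-other i a j j≢i j≢1+i))

Θ-avoids123⇔ : ∀ i d x → Avoids123 x ⇔ Avoids123 (Θ i d x)
Θ-avoids123⇔ i d x = mk⇔
  (λ x-avoids z-contains → x-avoids (Contains123ᵢ⇒Contains123 x (Θ-reflects-123 (Contains123⇒Contains123ᵢ z z-contains))))
  (λ z-avoids x-contains → z-avoids (Contains123ᵢ⇒Contains123 z (Θ-preserves-123 (Contains123⇒Contains123ᵢ x x-contains))))
  where open Raising i d x

mainTheorem6 : (k : ℕ) (a : ℕ → ℕ) →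
    (∀ j → 1 ≤ j → j ≤ k → 1 ≤ a j) →
    (i : ℕ) → 1 ≤ i → i < k → a (suc i) < a i →
    let d = a i ∸ a (suc i)
        b = swapAt i a
    in (∀ x → IsPermOf k a x → d ≤ length (unmatched i x))
       × (∀ x → IsPermOf k a x → IsPermOf k b (Θ i d x))
       × (∀ x y → IsPermOf k a x → IsPermOf k a y → Θ i d x ≡ Θ i d y → x ≡ y)
       × (∀ y → IsPermOf k b y → ∃ λ x → IsPermOf k a x × Θ i d x ≡ y)
       × (∀ x → IsPermOf k a x → (Avoids123 x ⇔ Avoids123 (Θ i d x)))
mainTheorem6 k a _ i 1≤i i<k aᵢ₊₁<aᵢ =
    (λ _ → perm⇒d≤unmatched 1≤i i<k aᵢ₊₁≤aᵢ)
  , (λ _ → Θ-IsPermOf 1≤i i<k aᵢ₊₁≤aᵢ)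
  , (λ _ _ → Θ-injective-on-perms 1≤i i<k aᵢ₊₁≤aᵢ)
  , (λ _ → Θ-surjective-on-perms 1≤i i<k aᵢ₊₁≤aᵢ)
  , (λ x _ → Θ-avoids123⇔ i (a i ∸ a (suc i)) x)
  where aᵢ₊₁≤aᵢ = <⇒≤ aᵢ₊₁<aᵢ
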